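{- Let $\Sigma=\{a<b\}$ and let $w=w_1w_2\cdots w_n\in\Sigma^*$ with $w_1,\dots,w_n\in\Sigma$. Define $\tau\colon\{1,\dots,n\}\to\{1,\dots,n\}$ by $\tau(x)=i$ if $w_x=b$ and $x=\mathrm{pos}_b(w,i)$, and $\tau(x)=j+|w|_b$ if $w_x=a$ and $x=\mathrm{pos}_a(w,j)$. Then for all integers $1\le x<y\le n$, the vertices $x$ and $y$ are adjacent in $\mathcal{G}(w)$ if and only if $\tau(x)>\tau(y)$.
   Context: For a word $w$ and a letter $c$, $|w|_c$ denotes the number of occurrences of $c$ in $w$, and for $1\le k\le |w|_c$, $\mathrm{pos}_c(w,k)$ denotes the position in $w$ of the $k$-th occurrence of the letter $c$. The Parikh graph $\mathcal{G}(w)$ of $w=w_1\cdots w_n$ over the ordered alphabet $\{a<b\}$ is the simple undirected graph with vertex set $\{1,\dots,n\}$ in which, for $1\le i<j\le n$, vertices $i$ and $j$ are adjacent if and only if $w_i=a$ and $w_j=b$. -}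

module Defs where

open import Data.Nat using (ℕ; zero; suc; _+_)
open import Data.List using (List; []; _∷_; length; lookup)
open import Data.Fin using (Fin; toℕ)
open import Data.Maybe using (Maybe; just; nothing)
open import Data.Product using (_×_)
open import Relation.Binary.PropositionalEquality using (_≡_)
open import Relation.Nullary using (yes; no)

data Σ : Set where
  a b : Σ

_≟Σ_ : (c d : Σ) → Relation.Nullary.Dec (c ≡ d)
a ≟Σ a = yes Relation.Binary.PropositionalEquality.refl
a ≟Σ b = no (λ ())
b ≟Σ a = no (λ ())
b ≟Σ b = yes Relation.Binary.PropositionalEquality.refl

count : Σ → List Σ → ℕ
count c [] = 0
count c (d ∷ w) with c ≟Σ d
... | yes _ = suc (count c w)
... | no  _ = count c w

-- pos_c(w,k) : 1-based position of the k-th (k ≥ 1) occurrence of c in w;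
-- nothing if k = 0 or k > |w|_c.
pos : Σ → List Σ → ℕ → Maybe ℕ
pos c w zero = nothing
pos c [] (suc k) = nothing
pos c (d ∷ w) (suc k) with c ≟Σ d
pos c (d ∷ w) (suc zero)    | yes _ = just 1
pos c (d ∷ w) (suc (suc k)) | yes _ = Data.Maybe.map suc (pos c w (suc k))
... | no _ = Data.Maybe.map suc (pos c w (suc k))

-- letter at 1-based position x (1 ≤ x ≤ |w|), given as i : Fin |w| with x = toℕ i + 1
letter : (w : List Σ) → Fin (length w) → Σ
letter w i = lookup w i

-- Parikh graph G(w): for 1 ≤ i < j ≤ n, i ~ j iff w_i = a and w_j = b.
-- (Defined on pairs with i < j, as in the paper.)
ParikhAdj : (w : List Σ) → Fin (length w) → Fin (length w) → Set
ParikhAdj w i j = (letter w i ≡ a) × (letter w j ≡ b)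

module Submission where

-- For a position x of w and a letter c, let rank c w x be the
-- number of occurrences of c among w₁ … w_x.  When w_x = c, x is exactly the
-- (rank c w x)-th occurrence of c, so the defining clauses of τ say
--   τ x = rank b w x            if w_x = b,
--   τ x = rank a w x + |w|_b    if w_x = a.
-- Two facts about rank then settle the order of τ on a pair x < y:
--   * rank c is strictly increasing from x to y when w_y = c, so τ is
--     increasing on two positions carrying the same letter;
--   * 1 ≤ rank c w x ≤ |w|_c when w_x = c, so every b-position has a smaller
--     τ-value than every a-position.
-- Hence τ x > τ y holds precisely when w_x = a and w_y = b, i.e. when x and y
-- are adjacent in the Parikh graph.

open import Defs
open import Data.Nat using (ℕ; suc; _+_; _<_; _>_; _≤_; z≤n; s≤s)
open import Data.Nat.Properties
  using (<-≤-trans; +-monoˡ-<; +-monoˡ-≤; +-monoʳ-<; m<m+n; <⇒≯)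
open import Data.List using (List; length; _∷_; [])
open import Data.Fin using (Fin; toℕ; zero; suc)
open import Data.Maybe using (just; map)
open import Data.Product using (_×_; _,_; ∃-syntax)
open import Data.Empty using (⊥-elim)
open import Function.Bundles using (_⇔_; mk⇔)
open import Relation.Nullary using (¬_; Dec; yes; no)
open import Relation.Nullary.Decidable using (_×-dec_)
open import Relation.Binary.PropositionalEquality using (_≡_; refl; sym; trans; cong; subst₂)

rank : Σ → (w : List Σ) → Fin (length w) → ℕ
rank c (d ∷ w) zero    = count c (d ∷ [])
rank c (d ∷ w) (suc x) = count c (d ∷ []) + rank c w x

rank-is-occurrence-index : (c : Σ) (w : List Σ) (x : Fin (length w)) →
  letter w x ≡ c →
  ∃[ k ] (rank c w x ≡ suc k × pos c w (suc k) ≡ just (suc (toℕ x)))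
rank-is-occurrence-index a (a ∷ w) zero refl = 0 , refl , refl
rank-is-occurrence-index b (b ∷ w) zero refl = 0 , refl , refl
rank-is-occurrence-index c (d ∷ w) (suc x) wx≡c
  with rank-is-occurrence-index c w x wx≡c
rank-is-occurrence-index a (a ∷ w) (suc x) _ | k , r , p = suc k , cong suc r , cong (map suc) p
rank-is-occurrence-index a (b ∷ w) (suc x) _ | k , r , p = k     , r          , cong (map suc) p
rank-is-occurrence-index b (a ∷ w) (suc x) _ | k , r , p = k     , r          , cong (map suc) p
rank-is-occurrence-index b (b ∷ w) (suc x) _ | k , r , p = suc k , cong suc r , cong (map suc) p

rank-positive : (c : Σ) (w : List Σ) (x : Fin (length w)) →
  letter w x ≡ c → 1 ≤ rank c w x
rank-positive c w x wx≡c with rank-is-occurrence-index c w x wx≡c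
... | k , r , _ rewrite r = s≤s z≤n

rank≤count : (c : Σ) (w : List Σ) (x : Fin (length w)) → rank c w x ≤ count c w
rank≤count a (a ∷ w) zero    = s≤s z≤n
rank≤count a (b ∷ w) zero    = z≤n
rank≤count b (a ∷ w) zero    = z≤n
rank≤count b (b ∷ w) zero    = s≤s z≤n
rank≤count a (a ∷ w) (suc x) = s≤s (rank≤count a w x)
rank≤count a (b ∷ w) (suc x) = rank≤count a w x
rank≤count b (a ∷ w) (suc x) = rank≤count b w x
rank≤count b (b ∷ w) (suc x) = s≤s (rank≤count b w x)

rank-strictly-increases : (c : Σ) (w : List Σ) (x y : Fin (length w)) →
  toℕ x < toℕ y → letter w y ≡ c → rank c w x < rank c w y
rank-strictly-increases c (d ∷ w) zero    (suc y) _         wy≡c =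
  m<m+n (count c (d ∷ [])) (rank-positive c w y wy≡c)
rank-strictly-increases c (d ∷ w) (suc x) (suc y) (s≤s x<y) wy≡c =
  +-monoʳ-< (count c (d ∷ [])) (rank-strictly-increases c w x y x<y wy≡c)

parikhAdj? : (w : List Σ) (x y : Fin (length w)) → Dec (ParikhAdj w x y)
parikhAdj? w x y = (letter w x ≟Σ a) ×-dec (letter w y ≟Σ b)

module _ (w : List Σ) (τ : Fin (length w) → ℕ)
  (τ-on-b : ∀ (x : Fin (length w)) (i : ℕ) → 1 ≤ i → letter w x ≡ b →
     pos b w i ≡ just (suc (toℕ x)) → τ x ≡ i)
  (τ-on-a : ∀ (x : Fin (length w)) (j : ℕ) → 1 ≤ j → letter w x ≡ a →
     pos a w j ≡ just (suc (toℕ x)) → τ x ≡ j + count b w)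
  where

  τ-at-b : (x : Fin (length w)) → letter w x ≡ b → τ x ≡ rank b w x
  τ-at-b x wx≡b with rank-is-occurrence-index b w x wx≡b
  ... | k , r , p = trans (τ-on-b x (suc k) (s≤s z≤n) wx≡b p) (sym r)

  τ-at-a : (x : Fin (length w)) → letter w x ≡ a → τ x ≡ rank a w x + count b w
  τ-at-a x wx≡a with rank-is-occurrence-index a w x wx≡a
  ... | k , r , p = trans (τ-on-a x (suc k) (s≤s z≤n) wx≡a p) (cong (_+ count b w) (sym r))

  -- Every b-position precedes every a-position under τ:
  -- τ x ≤ |w|_b < 1 + |w|_b ≤ τ y.
  τ-b<τ-a : (x y : Fin (length w)) → letter w x ≡ b → letter w y ≡ a → τ x < τ y
  τ-b<τ-a x y wx≡b wy≡a = subst₂ _<_ (sym (τ-at-b x wx≡b)) (sym (τ-at-a y wy≡a))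
    (<-≤-trans (s≤s (rank≤count b w x)) (+-monoˡ-≤ (count b w) (rank-positive a w y wy≡a)))

  τ-increasing-on-letter : (c : Σ) (x y : Fin (length w)) → toℕ x < toℕ y →
    letter w x ≡ c → letter w y ≡ c → τ x < τ y
  τ-increasing-on-letter a x y x<y wx≡a wy≡a =
    subst₂ _<_ (sym (τ-at-a x wx≡a)) (sym (τ-at-a y wy≡a))
      (+-monoˡ-< (count b w) (rank-strictly-increases a w x y x<y wy≡a))
  τ-increasing-on-letter b x y x<y wx≡b wy≡b =
    subst₂ _<_ (sym (τ-at-b x wx≡b)) (sym (τ-at-b y wy≡b))
      (rank-strictly-increases b w x y x<y wy≡b)

  adjacent⇒inversion : (x y : Fin (length w)) → ParikhAdj w x y → τ y < τ x
  adjacent⇒inversion x y (wx≡a , wy≡b) = τ-b<τ-a y x wy≡b wx≡a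

  -- A non-adjacent pair x < y is not an inversion; the letters of x and y are
  -- passed explicitly so that the four cases can be told apart.
  non-adjacent⇒ascent : (x y : Fin (length w)) → toℕ x < toℕ y →
    ¬ ParikhAdj w x y → τ x < τ y
  non-adjacent⇒ascent x y x<y ¬adj = by-letters (letter w x) (letter w y) refl refl
    where
    by-letters : (cx cy : Σ) → letter w x ≡ cx → letter w y ≡ cy → τ x < τ y
    by-letters a a wx≡a wy≡a = τ-increasing-on-letter a x y x<y wx≡a wy≡a
    by-letters a b wx≡a wy≡b = ⊥-elim (¬adj (wx≡a , wy≡b))
    by-letters b a wx≡b wy≡a = τ-b<τ-a x y wx≡b wy≡a
    by-letters b b wx≡b wy≡b = τ-increasing-on-letter b x y x<y wx≡b wy≡b

proposition3p5 : (w : List Σ) (τ : Fin (length w) → ℕ) →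
    (∀ (x : Fin (length w)) (i : ℕ) → 1 ≤ i → letter w x ≡ b →
    pos b w i ≡ just (suc (toℕ x)) → τ x ≡ i) →
    (∀ (x : Fin (length w)) (j : ℕ) → 1 ≤ j → letter w x ≡ a →
    pos a w j ≡ just (suc (toℕ x)) → τ x ≡ j + count b w) →
    ∀ (x y : Fin (length w)) → toℕ x < toℕ y →
    ParikhAdj w x y ⇔ (τ x > τ y)
proposition3p5 w τ τ-on-b τ-on-a x y x<y =
  mk⇔ (adjacent⇒inversion w τ τ-on-b τ-on-a x y) inversion⇒adjacent
  where
  inversion⇒adjacent : τ x > τ y → ParikhAdj w x y
  inversion⇒adjacent τy<τx with parikhAdj? w x y
  ... | yes adj = adj
  ... | no ¬adj = ⊥-elim (<⇒≯ (non-adjacent⇒ascent w τ τ-on-b τ-on-a x y x<y ¬adj) τy<τx)
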